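{- Let $(\psi,\varphi)$ be a specification where $\varphi=\forall\pi_1\ldots\forall\pi_n\exists\pi_{n+1}\ldots\exists\pi_{n+m}\mathpunct{.}(\mathsf{F}\,\phi)\wedge\phi''$ with $\phi$ using no temporal operators other than (possibly nested) $\mathsf{X}$ and $\phi''$ temporal-operator-free. Then there is an effectively computable specification $(\psi',\varphi')$ with $\varphi'$ of the form $\forall\pi_1\ldots\forall\pi_n\exists\pi_{n+1}\ldots\exists\pi_{n+m}\mathpunct{.}(\mathsf{F}\,\chi)\wedge\chi''$ with $\chi,\chi''$ temporal-operator-free, such that $(\psi,\varphi)$ is satisfiable iff $(\psi',\varphi')$ is satisfiable.
   Context: Fix a finite set $\mathit{AP}$ of atomic propositions and $\Sigma=2^{\mathit{AP}}$; traces are elements of $\Sigma^\omega$. LTL: $\psi ::= a \mid \neg\psi \mid \psi\wedge\psi \mid \mathsf{X}\psi \mid \psi\,\mathsf{U}\,\psi$ with standard semantics, $\mathsf{F}\psi=\top\mathsf{U}\psi$. HyperLTL: $\varphi ::= \exists\pi\mathpunct{.}\varphi \mid \forall\pi\mathpunct{.}\varphi \mid \phi$, $\phi ::= a_\pi \mid \neg\phi\mid\phi\wedge\phi\mid\mathsf{X}\phi\mid\phi\,\mathsf{U}\,\phi$ (closed); semantics w.r.t. a set of traces $T$ with quantifiers over $T$ and temporal operators shifting all bound traces synchronously. A specification $(\psi,\varphi)$ is satisfiable iff there is a non-empty $T\subseteq\Sigma^\omega$ with every $t\in T$ satisfying $\psi$ and $T\models\varphi$. (The new specification may be over a different, effectively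 computed set of atomic propositions.) -}

module Defs where

open import Data.Nat using (ℕ; zero; suc; _+_; _≤_; _<_)
open import Data.Fin using (Fin)
open import Data.Bool using (Bool; true)
open import Data.Product using (Σ; _×_; ∃)
open import Data.Unit using (⊤)
open import Data.Empty using (⊥)
open import Relation.Nullary using (¬_)
open import Relation.Binary.PropositionalEquality using (_≡_)
open import Level using () renaming (suc to lsuc; zero to lzero)

Letter : ℕ → Set
Letter k = Fin k → Bool

Trace : ℕ → Set
Trace k = ℕ → Letter k

data LTL (k : ℕ) : Set where
  atom : Fin k → LTL k
  ¬ₗ_  : LTL k → LTL k
  _∧ₗ_ : LTL k → LTL k → LTL k
  Xₗ   : LTL k → LTL k
  _Uₗ_ : LTL k → LTL k → LTL k

_,_⊨ₗ_ : ∀ {k} → Trace k → ℕ → LTL k → Set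
t , i ⊨ₗ atom a  = t i a ≡ true
t , i ⊨ₗ (¬ₗ ψ)  = ¬ (t , i ⊨ₗ ψ)
t , i ⊨ₗ (ψ ∧ₗ χ) = (t , i ⊨ₗ ψ) × (t , i ⊨ₗ χ)
t , i ⊨ₗ Xₗ ψ    = t , suc i ⊨ₗ ψ
t , i ⊨ₗ (ψ Uₗ χ) = Σ ℕ λ j → (i ≤ j) × (t , j ⊨ₗ χ) × (∀ l → i ≤ l → l < j → t , l ⊨ₗ ψ)

_⊨ₗ_ : ∀ {k} → Trace k → LTL k → Set
t ⊨ₗ ψ = t , 0 ⊨ₗ ψ

-- Quantifier-free HyperLTL bodies over AP = Fin k with p trace variables
-- (variables are Fin p).  ⊤ₕ is the constant true used in F φ = ⊤ U φ.

data Body (k p : ℕ) : Set where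
  ⊤ₕ   : Body k p
  atom : Fin k → Fin p → Body k p
  ¬ₕ_  : Body k p → Body k p
  _∧ₕ_ : Body k p → Body k p → Body k p
  Xₕ   : Body k p → Body k p
  _Uₕ_ : Body k p → Body k p → Body k p

Fₕ : ∀ {k p} → Body k p → Body k p
Fₕ φ = ⊤ₕ Uₕ φ

Assignment : ℕ → ℕ → Set
Assignment k p = Fin p → Trace k

_,_⊨ₕ_ : ∀ {k p} → Assignment k p → ℕ → Body k p → Set
Π , i ⊨ₕ ⊤ₕ        = ⊤
Π , i ⊨ₕ atom a π  = Π π i a ≡ true
Π , i ⊨ₕ (¬ₕ φ)    = ¬ (Π , i ⊨ₕ φ)
Π , i ⊨ₕ (φ ∧ₕ χ)  = (Π , i ⊨ₕ φ) × (Π , i ⊨ₕ χ)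
Π , i ⊨ₕ Xₕ φ      = Π , suc i ⊨ₕ φ
Π , i ⊨ₕ (φ Uₕ χ)  = Σ ℕ λ j → (i ≤ j) × (Π , j ⊨ₕ χ) × (∀ l → i ≤ l → l < j → Π , l ⊨ₕ φ)

data XOnly {k p : ℕ} : Body k p → Set where
  ⊤ₕ   : XOnly ⊤ₕ
  atom : ∀ a π → XOnly (atom a π)
  ¬ₕ_  : ∀ {φ} → XOnly φ → XOnly (¬ₕ φ)
  _∧ₕ_ : ∀ {φ χ} → XOnly φ → XOnly χ → XOnly (φ ∧ₕ χ)
  Xₕ   : ∀ {φ} → XOnly φ → XOnly (Xₕ φ)

data TFree {k p : ℕ} : Body k p → Set where
  ⊤ₕ   : TFree ⊤ₕ
  atom : ∀ a π → TFree (atom a π)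
  ¬ₕ_  : ∀ {φ} → TFree φ → TFree (¬ₕ φ)
  _∧ₕ_ : ∀ {φ χ} → TFree φ → TFree χ → TFree (φ ∧ₕ χ)

-- HyperLTL formulas with p free trace variables; the newly bound
-- variable is Fin.zero (de Bruijn).  Closed formulas: Hyper k 0.

data Hyper (k p : ℕ) : Set where
  ∃ₕ   : Hyper k (suc p) → Hyper k p
  ∀ₕ   : Hyper k (suc p) → Hyper k p
  body : Body k p → Hyper k p

extend : ∀ {k p} → Trace k → Assignment k p → Assignment k (suc p)
extend t Π Fin.zero    = t
extend t Π (Fin.suc x) = Π x

_,_⊨H_ : ∀ {k p} → (Trace k → Set) → Assignment k p → Hyper k p → Set
T , Π ⊨H ∃ₕ φ   = Σ (Trace _) λ t → T t × (T , extend t Π ⊨H φ)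
T , Π ⊨H ∀ₕ φ   = ∀ t → T t → T , extend t Π ⊨H φ
T , Π ⊨H body φ = Π , 0 ⊨ₕ φ

emptyAssignment : ∀ {k} → Assignment k 0
emptyAssignment ()

_⊨H_ : ∀ {k} → (Trace k → Set) → Hyper k 0 → Set
T ⊨H φ = T , emptyAssignment ⊨H φ

∀s : ∀ {k p} (n : ℕ) → Hyper k (n + p) → Hyper k p
∀s zero    φ = φ
∀s (suc n) φ = ∀s n (∀ₕ φ)

∃s : ∀ {k p} (m : ℕ) → Hyper k (m + p) → Hyper k p
∃s zero    φ = φ
∃s (suc m) φ = ∃s m (∃ₕ φ)

∀∃ : ∀ {k} (n m : ℕ) → Body k (m + (n + 0)) → Hyper k 0
∀∃ n m φ = ∀s n (∃s m (body φ))

record Spec : Set where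
  constructor spec
  field
    nAP  : ℕ
    ψ    : LTL nAP
    φ    : Hyper nAP 0

Satisfiable : Spec → Set₁
Satisfiable (spec k ψ φ) =
  Σ (Trace k → Set) λ T →
    (∃ λ t → T t) × (∀ t → T t → t ⊨ₗ ψ) × (T ⊨H φ)

record InputSpec : Set where
  field
    nAP   : ℕ
    n m   : ℕ
    ψ     : LTL nAP
    φ     : Body nAP (m + (n + 0))
    φ-X   : XOnly φ
    φ''   : Body nAP (m + (n + 0))
    φ''-T : TFree φ''

toSpec : InputSpec → Spec
toSpec I = spec nAP ψ (∀∃ n m (Fₕ φ ∧ₕ φ''))
  where open InputSpec I

record OutputSpec (n m : ℕ) : Set where
  field
    nAP   : ℕ
    ψ     : LTL nAP
    χ     : Body nAP (m + (n + 0))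
    χ-T   : TFree χ
    χ''   : Body nAP (m + (n + 0))
    χ''-T : TFree χ''

fromOut : ∀ {n m} → OutputSpec n m → Spec
fromOut {n} {m} O = spec nAP ψ (∀∃ n m (Fₕ χ ∧ₕ χ''))
  where open OutputSpec O

-- A satisfying trace set may be replaced by its set of D-windows, where D
-- bounds the X-nesting of φ: the window of t at position i records the
-- letters t(i), …, t(i+D) as atomic propositions (o, a), o ≤ D.  The LTL part
-- then additionally demands that consecutive windows overlap consistently,
-- which makes every trace in the new model the window of a unique original
-- trace, and X^o a_π becomes the atom (o, a)_π.  Since windows are taken
-- trace by trace, quantifiers over the two models correspond, so both
-- specifications are equisatisfiable while χ, χ'' are temporal-operator-free.
module Submission where

open import Defs
open import Data.Bool using (true; false)
import Data.Bool.Properties as Bool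
open import Data.Empty using (⊥-elim)
open import Data.Fin using (Fin; toℕ; fromℕ<; combine; remQuot)
open import Data.Fin.Properties using (toℕ-fromℕ<; remQuot-combine)
open import Data.List using (List; []; _∷_; foldr; map; cartesianProduct; upTo; allFin)
open import Data.List.Membership.Propositional.Properties
  using (∈-cartesianProduct⁺; ∈-cartesianProduct⁻; ∈-upTo⁺; ∈-upTo⁻; ∈-allFin)
open import Data.List.Relation.Unary.All as All using (All; []; _∷_)
open import Data.List.Relation.Unary.All.Properties using (map⁺; map⁻)
open import Data.Nat using (ℕ; zero; suc; _+_; _*_; _≤_; _<_; _⊔_; z≤n; s≤s)
open import Data.Nat.Properties
  using (+-suc; ≤-trans; <⇒≤; +-monoʳ-≤; m+n≤o⇒m≤o; m⊓n≤n; m≤n⇒m⊓n≡m; m≤m⊔n; m≤n⊔m)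
open import Data.Product using (Σ; _×_; _,_; proj₁; proj₂)
open import Data.Product.Function.NonDependent.Propositional using (_×-⇔_)
open import Function using (id; _∘_)
open import Function.Bundles using (_⇔_; mk⇔; Equivalence)
open import Function.Related.TypeIsomorphisms using (¬-cong-⇔)
open import Relation.Nullary using (¬_; decidable-stable)
open import Relation.Binary.PropositionalEquality using (_≡_; refl; sym; trans; cong; subst; module ≡-Reasoning)

open Equivalence using (to; from)

-- Defs gives its satisfaction relations no fixity, so  t , i ⊨ₗ ψ  does not
-- parse next to pairing; these are the same relations under unambiguous names.
infix 4 _[_]⊨ₗ_ _[_]⊨ₕ_ _[_]⊨H_

_[_]⊨ₗ_ : ∀ {k} → Trace k → ℕ → LTL k → Set
_[_]⊨ₗ_ = _,_⊨ₗ_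

_[_]⊨ₕ_ : ∀ {k p} → Assignment k p → ℕ → Body k p → Set
_[_]⊨ₕ_ = _,_⊨ₕ_

_[_]⊨H_ : ∀ {k p} → (Trace k → Set) → Assignment k p → Hyper k p → Set
_[_]⊨H_ = _,_⊨H_

Until : (ℕ → Set) → (ℕ → Set) → ℕ → Set
Until P Q i = Σ ℕ λ j → (i ≤ j) × Q j × (∀ l → i ≤ l → l < j → P l)

Until-cong : ∀ {P P′ Q Q′ : ℕ → Set} {i} →
             (∀ l → P l ⇔ P′ l) → (∀ j → Q j ⇔ Q′ j) → Until P Q i ⇔ Until P′ Q′ i
Until-cong P⇔P′ Q⇔Q′ = mk⇔
  (λ (j , i≤j , q , p) → j , i≤j , to (Q⇔Q′ j) q , λ l i≤l l<j → to (P⇔P′ l) (p l i≤l l<j))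
  (λ (j , i≤j , q , p) → j , i≤j , from (Q⇔Q′ j) q , λ l i≤l l<j → from (P⇔P′ l) (p l i≤l l<j))

bool-≡⇔ : ∀ x y → (¬ (x ≡ true × ¬ y ≡ true) × ¬ (y ≡ true × ¬ x ≡ true)) ⇔ (x ≡ y)
bool-≡⇔ x y = mk⇔ (to′ x y) λ { refl → (λ (p , ¬p) → ¬p p) , (λ (p , ¬p) → ¬p p) }
  where
  to′ : ∀ x y → ¬ (x ≡ true × ¬ y ≡ true) × ¬ (y ≡ true × ¬ x ≡ true) → x ≡ y
  to′ true  true  _         = refl
  to′ false false _         = refl
  to′ true  false (¬tf , _) = ⊥-elim (¬tf (refl , λ ()))
  to′ false true  (_ , ¬tf) = ⊥-elim (¬tf (refl , λ ()))

module _ {k : ℕ} where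

  renameₗ : ∀ {k′} → (Fin k → Fin k′) → LTL k → LTL k′
  renameₗ ρ (atom a)  = atom (ρ a)
  renameₗ ρ (¬ₗ ψ)    = ¬ₗ (renameₗ ρ ψ)
  renameₗ ρ (ψ ∧ₗ χ)  = renameₗ ρ ψ ∧ₗ renameₗ ρ χ
  renameₗ ρ (Xₗ ψ)    = Xₗ (renameₗ ρ ψ)
  renameₗ ρ (ψ Uₗ χ)  = renameₗ ρ ψ Uₗ renameₗ ρ χ

  ⊨renameₗ : ∀ {k′} {ρ : Fin k → Fin k′} {t : Trace k} {t′ : Trace k′} →
             (∀ i a → t′ i (ρ a) ≡ t i a) → ∀ ψ i → (t′ [ i ]⊨ₗ renameₗ ρ ψ) ⇔ (t [ i ]⊨ₗ ψ)
  ⊨renameₗ t′≗t (atom a) i = mk⇔ (trans (sym (t′≗t i a))) (trans (t′≗t i a))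
  ⊨renameₗ t′≗t (¬ₗ ψ)   i = ¬-cong-⇔ (⊨renameₗ t′≗t ψ i)
  ⊨renameₗ t′≗t (ψ ∧ₗ χ) i = ⊨renameₗ t′≗t ψ i ×-⇔ ⊨renameₗ t′≗t χ i
  ⊨renameₗ t′≗t (Xₗ ψ)   i = ⊨renameₗ t′≗t ψ (suc i)
  ⊨renameₗ t′≗t (ψ Uₗ χ) i = Until-cong (⊨renameₗ t′≗t ψ) (⊨renameₗ t′≗t χ)

  -- LTL has no constant true (and AP may be empty), so ¬ (c ∧ ¬ c) stands in for it.
  Gₗ : LTL k → LTL k
  Gₗ c = ¬ₗ ((¬ₗ (c ∧ₗ (¬ₗ c))) Uₗ (¬ₗ c))

  Gₗ-intro : ∀ {t c} → (∀ j → t [ j ]⊨ₗ c) → t ⊨ₗ Gₗ c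
  Gₗ-intro always (j , _ , ¬c , _) = ¬c (always j)

  Gₗ-elim : ∀ {t c} → t ⊨ₗ Gₗ c → ∀ j → ¬ ¬ (t [ j ]⊨ₗ c)
  Gₗ-elim g j ¬c = g (j , z≤n , ¬c , λ _ _ _ (c , ¬c′) → ¬c′ c)

  _↔ₗ_ : LTL k → LTL k → LTL k
  ψ ↔ₗ χ = (¬ₗ (ψ ∧ₗ (¬ₗ χ))) ∧ₗ (¬ₗ (χ ∧ₗ (¬ₗ ψ)))

  ⊨atom↔ₗXatom : ∀ {t i a b} → (t [ i ]⊨ₗ (atom a ↔ₗ Xₗ (atom b))) ⇔ (t i a ≡ t (suc i) b)
  ⊨atom↔ₗXatom {t} {i} {a} {b} = bool-≡⇔ (t i a) (t (suc i) b)

  ⊨foldr-∧ₗ : ∀ {t i b} (cs : List (LTL k)) →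
              (t [ i ]⊨ₗ foldr _∧ₗ_ b cs) ⇔ (All (t [ i ]⊨ₗ_) cs × t [ i ]⊨ₗ b)
  ⊨foldr-∧ₗ []       = mk⇔ ([] ,_) proj₂
  ⊨foldr-∧ₗ (c ∷ cs) = mk⇔
    (λ (hc , h) → let (hs , hb) = to (⊨foldr-∧ₗ cs) h in hc ∷ hs , hb)
    (λ { (hc ∷ hs , hb) → hc , from (⊨foldr-∧ₗ cs) (hs , hb) })

module _ {k p : ℕ} where

  TFree⇒XOnly : {φ : Body k p} → TFree φ → XOnly φ
  TFree⇒XOnly ⊤ₕ         = ⊤ₕ
  TFree⇒XOnly (atom a π) = atom a π
  TFree⇒XOnly (¬ₕ φ)     = ¬ₕ TFree⇒XOnly φ
  TFree⇒XOnly (φ ∧ₕ χ)   = TFree⇒XOnly φ ∧ₕ TFree⇒XOnly χ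

  depth : {φ : Body k p} → XOnly φ → ℕ
  depth ⊤ₕ         = 0
  depth (atom a π) = 0
  depth (¬ₕ φ)     = depth φ
  depth (φ ∧ₕ χ)   = depth φ ⊔ depth χ
  depth (Xₕ φ)     = suc (depth φ)

module Transfer {k k′ : ℕ} (R : Trace k → Trace k′ → Set) where

  Related : ∀ {p} → Assignment k p → Assignment k′ p → Set
  Related Π Π′ = ∀ π → R (Π π) (Π′ π)

  extend-related : ∀ {p} {Π : Assignment k p} {Π′ t t′} →
                   R t t′ → Related Π Π′ → Related (extend t Π) (extend t′ Π′)
  extend-related r rel Fin.zero    = r
  extend-related r rel (Fin.suc π) = rel π

  BodyAgrees : ∀ {p} → Body k p → Body k′ p → Set
  BodyAgrees B B′ = ∀ {Π Π′} → Related Π Π′ → (Π [ 0 ]⊨ₕ B) ⇔ (Π′ [ 0 ]⊨ₕ B′)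

  module _ (T : Trace k → Set) (T′ : Trace k′ → Set)
           (cover  : ∀ {t}  → T t   → Σ (Trace k′) λ t′ → T′ t′ × R t t′)
           (cover′ : ∀ {t′} → T′ t′ → Σ (Trace k)  λ t  → T t   × R t t′) where

    Equisatisfiable : ∀ {p} → Hyper k p → Hyper k′ p → Set
    Equisatisfiable H H′ = ∀ {Π Π′} → Related Π Π′ → (T [ Π ]⊨H H) ⇔ (T′ [ Π′ ]⊨H H′)

    ∃ₕ-equisat : ∀ {p} {H : Hyper k (suc p)} {H′} → Equisatisfiable H H′ → Equisatisfiable (∃ₕ H) (∃ₕ H′)
    ∃ₕ-equisat H≈H′ rel = mk⇔
      (λ (t , Tt , h) → let (t′ , T′t′ , r) = cover Tt in
                         t′ , T′t′ , to (H≈H′ (extend-related r rel)) h)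
      (λ (t′ , T′t′ , h) → let (t , Tt , r) = cover′ T′t′ in
                         t , Tt , from (H≈H′ (extend-related r rel)) h)

    ∀ₕ-equisat : ∀ {p} {H : Hyper k (suc p)} {H′} → Equisatisfiable H H′ → Equisatisfiable (∀ₕ H) (∀ₕ H′)
    ∀ₕ-equisat H≈H′ rel = mk⇔
      (λ h t′ T′t′ → let (t , Tt , r) = cover′ T′t′ in to (H≈H′ (extend-related r rel)) (h t Tt))
      (λ h t Tt → let (t′ , T′t′ , r) = cover Tt in from (H≈H′ (extend-related r rel)) (h t′ T′t′))

    ∃s-equisat : ∀ m {p} {H : Hyper k (m + p)} {H′} → Equisatisfiable H H′ → Equisatisfiable (∃s m H) (∃s m H′)
    ∃s-equisat zero    H≈H′ = H≈H′
    ∃s-equisat (suc m) {H = H} {H′} H≈H′ = ∃s-equisat m {H = ∃ₕ H} {∃ₕ H′} (∃ₕ-equisat {H = H} {H′} H≈H′)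

    ∀s-equisat : ∀ n {p} {H : Hyper k (n + p)} {H′} → Equisatisfiable H H′ → Equisatisfiable (∀s n H) (∀s n H′)
    ∀s-equisat zero    H≈H′ = H≈H′
    ∀s-equisat (suc n) {H = H} {H′} H≈H′ = ∀s-equisat n {H = ∀ₕ H} {∀ₕ H′} (∀ₕ-equisat {H = H} {H′} H≈H′)

    ⊨∀∃-equisat : ∀ n m {B B′} → BodyAgrees B B′ → (T ⊨H ∀∃ n m B) ⇔ (T′ ⊨H ∀∃ n m B′)
    ⊨∀∃-equisat n m B≈B′ = ∀s-equisat n (∃s-equisat m B≈B′) (λ ())

  -- The new model is the R-image of the old one and vice versa.
  satisfiable-transfer :
    ∀ {ψ ψ′ n m B B′} →
    (∀ t → Σ (Trace k′) (R t)) →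
    (∀ t′ → t′ ⊨ₗ ψ′ → Σ (Trace k) λ t → R t t′) →
    (∀ {t t′} → R t t′ → (t′ ⊨ₗ ψ′) ⇔ (t ⊨ₗ ψ)) →
    BodyAgrees B B′ →
    Satisfiable (spec k ψ (∀∃ n m B)) ⇔ Satisfiable (spec k′ ψ′ (∀∃ n m B′))
  satisfiable-transfer {ψ} {ψ′} {n} {m} {B} {B′} encode decode ψ-agrees B≈B′ = mk⇔ forward backward
    where
    forward : Satisfiable (spec k ψ (∀∃ n m B)) → Satisfiable (spec k′ ψ′ (∀∃ n m B′))
    forward (T , (t₀ , Tt₀) , Tψ , T⊨) =
      T′ , (let (t′ , T′t′ , _) = cover Tt₀ in t′ , T′t′) , T′ψ′ ,
      to (⊨∀∃-equisat T T′ cover id n m B≈B′) T⊨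
      where
      T′ : Trace k′ → Set
      T′ t′ = Σ (Trace k) λ t → T t × R t t′
      T′ψ′ : ∀ t′ → T′ t′ → t′ ⊨ₗ ψ′
      T′ψ′ t′ (t , Tt , r) = from (ψ-agrees r) (Tψ t Tt)
      cover : ∀ {t} → T t → Σ (Trace k′) λ t′ → T′ t′ × R t t′
      cover {t} Tt = let (t′ , r) = encode t in t′ , (t , Tt , r) , r

    backward : Satisfiable (spec k′ ψ′ (∀∃ n m B′)) → Satisfiable (spec k ψ (∀∃ n m B))
    backward (T′ , (t₀ , T′t₀) , T′ψ′ , T′⊨) =
      T , (let (t , Tt , _) = cover′ T′t₀ in t , Tt) , Tψ ,
      from (⊨∀∃-equisat T T′ id cover′ n m B≈B′) T′⊨
      where
      T : Trace k → Set
      T t = Σ (Trace k′) λ t′ → T′ t′ × R t t′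
      Tψ : ∀ t → T t → t ⊨ₗ ψ
      Tψ t (t′ , T′t′ , r) = to (ψ-agrees r) (T′ψ′ t′ T′t′)
      cover′ : ∀ {t′} → T′ t′ → Σ (Trace k) λ t → T t × R t t′
      cover′ {t′} T′t′ = let (t , r) = decode t′ (T′ψ′ t′ T′t′) in t , (t′ , T′t′ , r) , r

module Window (k D : ℕ) where

  open Transfer

  K : ℕ
  K = suc D * k

  -- Offsets beyond D are clamped to D; they never occur below.
  slot : ℕ → Fin k → Fin K
  slot o a = combine (fromℕ< (s≤s (m⊓n≤n o D))) a

  window : Trace k → Trace K
  window t i c = let (o , a) = remQuot {suc D} k c in t (toℕ o + i) a

  origin : Trace K → Trace k
  origin t′ i a = t′ i (slot 0 a)

  IsWindow : Trace k → Trace K → Set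
  IsWindow t t′ = ∀ {o} → o ≤ D → ∀ i a → t′ i (slot o a) ≡ t (o + i) a

  Coherent : Trace K → Set
  Coherent t′ = ∀ {o} → o < D → ∀ a i → t′ i (slot (suc o) a) ≡ t′ (suc i) (slot o a)

  window-isWindow : ∀ t → IsWindow t (window t)
  window-isWindow t {o} o≤D i a = begin
    window t i (slot o a)    ≡⟨ cong (λ (q , b) → t (toℕ q + i) b) (remQuot-combine _ a) ⟩
    t (toℕ (fromℕ< _) + i) a ≡⟨ cong (λ q → t (q + i) a) (trans (toℕ-fromℕ< _) (m≤n⇒m⊓n≡m o≤D)) ⟩
    t (o + i) a              ∎
    where open ≡-Reasoning

  isWindow⇒coherent : ∀ {t t′} → IsWindow t t′ → Coherent t′
  isWindow⇒coherent {t} {t′} w {o} o<D a i = begin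
    t′ i (slot (suc o) a)    ≡⟨ w o<D i a ⟩
    t (suc (o + i)) a        ≡⟨ cong (λ j → t j a) (+-suc o i) ⟨
    t (o + suc i) a          ≡⟨ w (<⇒≤ o<D) (suc i) a ⟨
    t′ (suc i) (slot o a)    ∎
    where open ≡-Reasoning

  coherent⇒isWindow : ∀ {t′} → Coherent t′ → IsWindow (origin t′) t′
  coherent⇒isWindow         c {zero}  _   i a = refl
  coherent⇒isWindow {t′} c {suc o} o<D i a = begin
    t′ i (slot (suc o) a)    ≡⟨ c o<D a i ⟩
    t′ (suc i) (slot o a)    ≡⟨ coherent⇒isWindow {t′} c (<⇒≤ o<D) (suc i) a ⟩
    origin t′ (o + suc i) a  ≡⟨ cong (λ j → origin t′ j a) (+-suc o i) ⟩
    origin t′ (suc o + i) a  ∎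
    where open ≡-Reasoning

  overlapping : ℕ × Fin k → LTL K
  overlapping (o , a) = atom (slot (suc o) a) ↔ₗ Xₗ (atom (slot o a))

  coherence : List (LTL K)
  coherence = map (Gₗ ∘ overlapping) (cartesianProduct (upTo D) (allFin k))

  ⊨coherence⇔Coherent : ∀ {t′} → All (t′ ⊨ₗ_) coherence ⇔ Coherent t′
  ⊨coherence⇔Coherent {t′} = mk⇔
    (λ all {o} o<D a i →
      let always = All.lookup (map⁻ all) (∈-cartesianProduct⁺ (∈-upTo⁺ o<D) (∈-allFin a)) in
      decidable-stable (_ Bool.≟ _) λ ≢ →
        Gₗ-elim {t = t′} {overlapping (o , a)} always i (λ step → ≢ (to (⊨atom↔ₗXatom {t = t′} {i}) step)))
    (λ c → map⁺ (All.tabulate λ {(o , a)} o,a∈ →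
      Gₗ-intro {t = t′} {overlapping (o , a)} λ i →
        from (⊨atom↔ₗXatom {t = t′} {i}) (c (∈-upTo⁻ (proj₁ (∈-cartesianProduct⁻ _ _ o,a∈))) a i)))

  windowedₗ : LTL k → LTL K
  windowedₗ ψ = foldr _∧ₗ_ (renameₗ (slot 0) ψ) coherence

  ⊨windowedₗ⇒isWindow : ∀ {t′ ψ} → t′ ⊨ₗ windowedₗ ψ → IsWindow (origin t′) t′
  ⊨windowedₗ⇒isWindow {t′} ⊨ψ′ =
    coherent⇒isWindow {t′} (to (⊨coherence⇔Coherent {t′}) (proj₁ (to (⊨foldr-∧ₗ coherence) ⊨ψ′)))

  isWindow⇒⊨windowedₗ⇔ : ∀ {t t′ ψ} → IsWindow t t′ → (t′ ⊨ₗ windowedₗ ψ) ⇔ (t ⊨ₗ ψ)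
  isWindow⇒⊨windowedₗ⇔ {t} {t′} {ψ} w = mk⇔
    (λ ⊨ψ′ → to ⊨ψ (proj₂ (to (⊨foldr-∧ₗ coherence) ⊨ψ′)))
    (λ t⊨ψ → from (⊨foldr-∧ₗ coherence) (⊨coherence , from ⊨ψ t⊨ψ))
    where
    ⊨ψ : (t′ ⊨ₗ renameₗ (slot 0) ψ) ⇔ (t ⊨ₗ ψ)
    ⊨ψ = ⊨renameₗ (w z≤n) ψ 0
    ⊨coherence : All (t′ ⊨ₗ_) coherence
    ⊨coherence = from (⊨coherence⇔Coherent {t′}) (isWindow⇒coherent {t} {t′} w)

  flatten : ∀ {p} {φ : Body k p} → ℕ → XOnly φ → Body K p
  flatten o ⊤ₕ         = ⊤ₕ
  flatten o (atom a π) = atom (slot o a) π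
  flatten o (¬ₕ φ)     = ¬ₕ flatten o φ
  flatten o (φ ∧ₕ χ)   = flatten o φ ∧ₕ flatten o χ
  flatten o (Xₕ φ)     = flatten (suc o) φ

  flatten-TFree : ∀ {p} {φ : Body k p} o (φX : XOnly φ) → TFree (flatten o φX)
  flatten-TFree o ⊤ₕ         = ⊤ₕ
  flatten-TFree o (atom a π) = atom (slot o a) π
  flatten-TFree o (¬ₕ φ)     = ¬ₕ flatten-TFree o φ
  flatten-TFree o (φ ∧ₕ χ)   = flatten-TFree o φ ∧ₕ flatten-TFree o χ
  flatten-TFree o (Xₕ φ)     = flatten-TFree (suc o) φ

  ⊨flatten : ∀ {p} {φ : Body k p} {Π Π′} {o} (φX : XOnly φ) → o + depth φX ≤ D →
             Related IsWindow Π Π′ → ∀ i → (Π [ o + i ]⊨ₕ φ) ⇔ (Π′ [ i ]⊨ₕ flatten o φX)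
  ⊨flatten ⊤ₕ _ _ _ = mk⇔ id id
  ⊨flatten {Π = Π} {Π′} {o} (atom a π) le rel i = mk⇔ (trans slot≡) (trans (sym slot≡))
    where
    slot≡ : Π′ π i (slot o a) ≡ Π π (o + i) a
    slot≡ = rel π (m+n≤o⇒m≤o o le) i a
  ⊨flatten (¬ₕ φ) le rel i = ¬-cong-⇔ (⊨flatten φ le rel i)
  ⊨flatten {o = o} (φ ∧ₕ χ) le rel i =
    ⊨flatten φ (≤-trans (+-monoʳ-≤ o (m≤m⊔n _ _)) le) rel i ×-⇔
    ⊨flatten χ (≤-trans (+-monoʳ-≤ o (m≤n⊔m _ _)) le) rel i
  ⊨flatten {o = o} (Xₕ φ) le rel i = ⊨flatten φ (subst (_≤ D) (+-suc o _) le) rel i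

module WindowReduction (I : InputSpec) where

  open InputSpec I

  φ''-X : XOnly φ''
  φ''-X = TFree⇒XOnly φ''-T

  open Window nAP (depth φ-X ⊔ depth φ''-X)

  output : OutputSpec n m
  output = record
    { nAP = K ; ψ = windowedₗ ψ
    ; χ   = flatten 0 φ-X   ; χ-T   = flatten-TFree 0 φ-X
    ; χ'' = flatten 0 φ''-X ; χ''-T = flatten-TFree 0 φ''-X
    }

  equisatisfiable : Satisfiable (toSpec I) ⇔ Satisfiable (fromOut output)
  equisatisfiable = Transfer.satisfiable-transfer IsWindow {ψ} {windowedₗ ψ} {n} {m}
    (λ t → window t , window-isWindow t)
    (λ t′ ⊨ψ′ → origin t′ , ⊨windowedₗ⇒isWindow ⊨ψ′)
    isWindow⇒⊨windowedₗ⇔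
    (λ rel → Until-cong (λ _ → mk⇔ id id) (λ j → ⊨flatten φ-X (m≤m⊔n _ _) rel j)
             ×-⇔ ⊨flatten φ''-X (m≤n⊔m _ _) rel 0)

lemma4p6 : Σ ((I : InputSpec) → OutputSpec (InputSpec.n I) (InputSpec.m I)) λ f →
             (I : InputSpec) →
               (Satisfiable (toSpec I) → Satisfiable (fromOut (f I)))
               × (Satisfiable (fromOut (f I)) → Satisfiable (toSpec I))
lemma4p6 = WindowReduction.output , λ I →
  let open WindowReduction I in to equisatisfiable , from equisatisfiable
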